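{- Let $k\geq s\geq 2$. Every $k$-globally tree surviving Turing degree is also an $s$-globally tree surviving Turing degree.
   Context: A tree is a subset of $\omega^{<\omega}$ closed under initial segments. A $k$-tree is a tree in which every node has at least $1$ and at most $k$ immediate successors. A function $g:\omega\to\omega$ is $k$-globally tree surviving if it is not a path through any computable $k$-tree; a Turing degree is $k$-globally tree surviving if it computes a $k$-globally tree surviving function. -}

module Defs where

open import Data.Nat using (ℕ; zero; suc; _+_; _<_)
open import Data.Fin using (Fin)
open import Data.Vec using (Vec; []; _∷_; lookup)
open import Data.List using (List; []; _∷_; _++_; [_]; map; upTo)
open import Data.Product using (Σ; ∃; _×_; _,_)
open import Relation.Binary.PropositionalEquality using (_≡_)
open import Relation.Nullary using (¬_)
open import Function.Definitions using (Injective)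

-- Partial recursive functions relative to an oracle f : ℕ → ℕ
-- (Kleene's μ-recursive functions with an extra oracle basic function).

data Code : ℕ → Set where
  cZero : ∀ {n} → Code n
  cSucc : Code 1
  cProj : ∀ {n} → Fin n → Code n
  cOrc  : Code 1
  cComp : ∀ {m n} → Code m → Vec (Code n) m → Code n
  cPrec : ∀ {n} → Code n → Code (suc (suc n)) → Code (suc n)
  cMu   : ∀ {n} → Code (suc n) → Code n

mutual
  data Eval (f : ℕ → ℕ) : ∀ {n} → Code n → Vec ℕ n → ℕ → Set where
    eZero : ∀ {n} {xs : Vec ℕ n} → Eval f cZero xs 0
    eSucc : ∀ {x} → Eval f cSucc (x ∷ []) (suc x)
    eProj : ∀ {n} {i : Fin n} {xs} → Eval f (cProj i) xs (lookup xs i)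
    eOrc  : ∀ {x} → Eval f cOrc (x ∷ []) (f x)
    eComp : ∀ {m n} {g : Code m} {hs : Vec (Code n) m} {xs ys y} →
            EvalVec f hs xs ys → Eval f g ys y → Eval f (cComp g hs) xs y
    ePrec0 : ∀ {n} {g : Code n} {h : Code (suc (suc n))} {xs y} →
             Eval f g xs y → Eval f (cPrec g h) (0 ∷ xs) y
    ePrecS : ∀ {n} {g : Code n} {h : Code (suc (suc n))} {x xs r y} →
             Eval f (cPrec g h) (x ∷ xs) r → Eval f h (x ∷ r ∷ xs) y →
             Eval f (cPrec g h) (suc x ∷ xs) y
    eMu   : ∀ {n} {g : Code (suc n)} {xs y} →
            Eval f g (y ∷ xs) 0 →
            (∀ z → z < y → ∃ λ w → Eval f g (z ∷ xs) (suc w)) →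
            Eval f (cMu g) xs y

  data EvalVec (f : ℕ → ℕ) {n : ℕ} : ∀ {m} → Vec (Code n) m → Vec ℕ n → Vec ℕ m → Set where
    ev[] : ∀ {xs} → EvalVec f [] xs []
    ev∷  : ∀ {m} {h : Code n} {hs : Vec (Code n) m} {xs y ys} →
           Eval f h xs y → EvalVec f hs xs ys → EvalVec f (h ∷ hs) xs (y ∷ ys)

_≤T_ : (ℕ → ℕ) → (ℕ → ℕ) → Set
g ≤T f = Σ (Code 1) λ c → ∀ n → Eval f c (n ∷ []) (g n)

-- Computable = computable relative to the (computable) constant-0 oracle.
Computable : (ℕ → ℕ) → Set
Computable g = g ≤T (λ _ → 0)

tri : ℕ → ℕ
tri zero    = zero
tri (suc n) = suc n + tri n

pair : ℕ → ℕ → ℕ                       -- Cantor pairing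
pair a b = tri (a + b) + b

encode : List ℕ → ℕ
encode []       = 0
encode (x ∷ xs) = suc (pair x (encode xs))

ComputableSet : (List ℕ → Set) → Set
ComputableSet T = Σ (ℕ → ℕ) λ χ → Computable χ ×
                  (∀ σ → (T σ → χ (encode σ) ≡ 1) × (χ (encode σ) ≡ 1 → T σ))

IsTree : (List ℕ → Set) → Set
IsTree T = ∀ σ τ → T (σ ++ τ) → T σ

-- every node has at least 1 and at most k immediate successors
IsKTree : ℕ → (List ℕ → Set) → Set
IsKTree k T = IsTree T ×
  (∀ σ → T σ →
     (∃ λ n → T (σ ++ [ n ])) ×
     (∀ (h : Fin (suc k) → ℕ) → Injective _≡_ _≡_ h → ¬ (∀ i → T (σ ++ [ h i ]))))

IsPath : (ℕ → ℕ) → (List ℕ → Set) → Set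
IsPath g T = ∀ n → T (map g (upTo n))

GloballyTreeSurviving : ℕ → (ℕ → ℕ) → Set₁
GloballyTreeSurviving k g =
  ∀ (T : List ℕ → Set) → ComputableSet T → IsKTree k T → ¬ IsPath g T

DegreeGTS : ℕ → (ℕ → ℕ) → Set₁
DegreeGTS k f = Σ (ℕ → ℕ) λ g → (g ≤T f) × GloballyTreeSurviving k g

module Submission where

-- The notion of a k-tree only bounds the branching from above,
-- so for s ≤ k every s-tree is already a k-tree.  Consequently a function
-- that avoids every computable k-tree in particular avoids every computable
-- s-tree: k-global tree survival implies s-global tree survival, and the
-- same witness g ≤T f shows that the degree of f is s-globally tree
-- surviving.  (The hypothesis 2 ≤ s only excludes degenerate cases in the
-- paper; the argument does not need it.)

open import Defs
open import Data.Nat using (ℕ; suc; _≤_; s≤s)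
open import Data.List using (List)
open import Data.Fin using (Fin; inject≤)
open import Data.Fin.Properties using (inject≤-injective)
open import Data.Product using (_,_)
open import Relation.Binary.PropositionalEquality using (_≡_)
open import Function.Definitions using (Injective)

restrict-injective : ∀ {s k} (s≤k : s ≤ k) (h : Fin (suc k) → ℕ) →
  Injective _≡_ _≡_ h → Injective _≡_ _≡_ (λ i → h (inject≤ i (s≤s s≤k)))
restrict-injective s≤k h h-inj {i} {j} hi≡hj =
  inject≤-injective (s≤s s≤k) (s≤s s≤k) i j (h-inj hi≡hj)

-- Every s-tree is a k-tree when s ≤ k: if some node had k + 1 distinct
-- successors, the first s + 1 of them would violate the s-tree bound.
kTree-mono : ∀ {s k} → s ≤ k → (T : List ℕ → Set) → IsKTree s T → IsKTree k T
kTree-mono s≤k T (isTree , branching) = isTree , λ σ σ∈T →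
  let (extendible , atMost-s) = branching σ σ∈T in
  extendible , λ h h-inj allSucc →
    atMost-s (λ i → h (inject≤ i (s≤s s≤k)))
             (restrict-injective s≤k h h-inj)
             (λ i → allSucc (inject≤ i (s≤s s≤k)))

gts-antitone : ∀ {s k} → s ≤ k → (g : ℕ → ℕ) →
  GloballyTreeSurviving k g → GloballyTreeSurviving s g
gts-antitone s≤k g survives-k T T-computable T-sTree =
  survives-k T T-computable (kTree-mono s≤k T T-sTree)

degreeGTS-antitone : ∀ {s k} → s ≤ k → (f : ℕ → ℕ) → DegreeGTS k f → DegreeGTS s f
degreeGTS-antitone s≤k f (g , g≤Tf , survives-k) =
  g , g≤Tf , gts-antitone s≤k g survives-k

lemma3p6 : (k s : ℕ) → 2 ≤ s → s ≤ k → (f : ℕ → ℕ) → DegreeGTS k f → DegreeGTS s f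
lemma3p6 k s _ s≤k = degreeGTS-antitone s≤k
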